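{- Let $p \geq 0$ be an integer, and let the $p$-Bernoulli numbers $B_{n,p}$ ($n \geq 0$) be defined by the exponential generating function \[ \sum_{n\geq 0} B_{n,p}\frac{t^n}{n!} = {}_2F_1\left(1,1;p+2;1-e^{t}\right). \] Then \[ \sum_{n=0}^{\infty} B_{n,p}\frac{t^n}{n!} = \frac{(p+1)(t-H_p)e^{pt}}{(e^{t}-1)^{p+1}} + (p+1)\sum_{k=1}^{p}\binom{p}{k}\frac{H_k}{(e^{t}-1)^{k+1}}, \] as an identity of functions of $t$ on a punctured neighbourhood of $t=0$. The singularities at $t=0$ on the right-hand side cancel, so the right-hand side extends analytically to $t=0$ and its Taylor expansion there is the left-hand side.
   Context: ${}_2F_1(a,b;c;z)=\sum_{m\geq 0}\frac{(a)_m (b)_m}{(c)_m}\frac{z^m}{m!}$ is the Gaussian hypergeometric function. Here $(x)_m = x(x+1)\cdots(x+m-1)$ is the rising factorial. The series converges and is analytic for $|z|<1$, so ${}_2F_1(1,1;p+2;1-e^t)$ is analytic for $t$ near $0$. The numbers $B_{n,p}$ are defined as $n!$ times its Taylor coefficients at $t=0$. $H_n$ denotes the harmonic numbers: $H_0=0$ and $H_n=\sum_{j=1}^{n}\frac{1}{j}$ for $n\geq 1$. -}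

module Defs where

open import Data.Nat as ℕ using (ℕ; zero; suc; _!; _∸_)
open import Data.Nat.Properties using (_!≢0)
open import Data.Nat.Combinatorics using (_C_)
open import Data.Integer as ℤ using (ℤ; +_; -[1+_])
open import Data.Rational using (ℚ; _/_; _+_; _*_; _-_; -_; 0ℚ; 1ℚ)
open import Data.Vec using (Vec; []; _∷_; head; tabulate; zipWith; foldr)
open import Data.Fin using (toℕ)

ℕ→ℚ : ℕ → ℚ
ℕ→ℚ n = + n / 1

inv! : ℕ → ℚ
inv! n = (+ 1 / (n !)) {{n !≢0}}

Σ0 : ℕ → (ℕ → ℚ) → ℚ
Σ0 zero    f = f 0
Σ0 (suc n) f = Σ0 n f + f (suc n)

Σ1 : ℕ → (ℕ → ℚ) → ℚ
Σ1 zero    f = 0ℚ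
Σ1 (suc n) f = Σ1 n f + f (suc n)

H : ℕ → ℚ
H n = Σ1 n (λ { zero → 0ℚ ; (suc j) → + 1 / suc j })

-- Formal power series over ℚ (coefficient sequences)

PS : Set
PS = ℕ → ℚ

_⊕_ : PS → PS → PS
(f ⊕ g) n = f n + g n

_·_ : ℚ → PS → PS
(c · f) n = c * f n

_⊛_ : PS → PS → PS
(f ⊛ g) n = Σ0 n (λ i → f i * g (n ∸ i))

one : PS
one zero    = 1ℚ
one (suc _) = 0ℚ

X : PS
X (suc zero) = 1ℚ
X _          = 0ℚ

const : ℚ → PS
const c zero    = c
const c (suc _) = 0ℚ

_^ₚ_ : PS → ℕ → PS
f ^ₚ zero  = one
f ^ₚ suc k = f ⊛ (f ^ₚ k)

expPS : ℕ → PS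
expPS a n = ℕ→ℚ (a ℕ.^ n) * inv! n

expm1 : PS
expm1 zero    = 0ℚ
expm1 (suc n) = inv! (suc n)

oneMinusExp : PS
oneMinusExp n = - expm1 n

-- g(t) = (e^t - 1)/t = Σ t^n/(n+1)!, so that e^t - 1 = t · g(t) and g(0) = 1
g : PS
g n = inv! (suc n)

-- Multiplicative inverse of a power series f with constant term 1:
-- h_0 = 1,  h_n = - Σ_{j=1}^{n} f_j h_{n-j}.
-- invVec f n = (h_n , h_{n-1} , … , h_0).
invVec : PS → (n : ℕ) → Vec ℚ (suc n)
invVec f zero    = 1ℚ ∷ []
invVec f (suc n) =
  let v = invVec f n in
  (- foldr _ _+_ 0ℚ (zipWith _*_ (tabulate (λ i → f (suc (toℕ i)))) v)) ∷ v

inv₁ : PS → PS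
inv₁ f n = head (invVec f n)

-- c_m = (a)_m (b)_m / ((c)_m m!)  for  c = suc c'  (so that (c)_m ≠ 0)
hypCoeff : ℕ → ℕ → ℕ → ℕ → ℚ
hypCoeff a b c' zero    = 1ℚ
hypCoeff a b c' (suc m) =
  hypCoeff a b c' m * ((+ (a ℕ.+ m) / suc (c' ℕ.+ m)) * (+ (b ℕ.+ m) / suc m))

-- Composition Σ_m c_m u^m of a coefficient sequence with a power series
-- u having u 0 = 0 (so only m ≤ n contribute to the coefficient of t^n).
compose : (ℕ → ℚ) → PS → PS
compose c u n = Σ0 n (λ m → c m * (u ^ₚ m) n)

₂F₁∘ : ℕ → ℕ → ℕ → PS → PS
₂F₁∘ a b c' u = compose (hypCoeff a b c') u

-- p-Bernoulli numbers: B_{n,p} = n! [t^n] 2F1(1,1;p+2;1-e^t)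
Bp : ℕ → ℕ → ℚ
Bp n p = ℕ→ℚ (n !) * ₂F₁∘ 1 1 (suc p) oneMinusExp n

-- Formal Laurent series over ℚ as coefficient functions ℤ → ℚ

LS : Set
LS = ℤ → ℚ

ps→ls : PS → LS
ps→ls f (+ n)    = f n
ps→ls f -[1+ _ ] = 0ℚ

-- t^{-k} · f  : coefficient of t^z is f_{z+k}
t⁻^_⊗_ : ℕ → PS → LS
(t⁻^ k ⊗ f) z with z ℤ.+ + k
... | + n      = f n
... | -[1+ _ ] = 0ℚ

_⊕ₗ_ : LS → LS → LS
(f ⊕ₗ g) z = f z + g z

_·ₗ_ : ℚ → LS → LS
(c ·ₗ f) z = c * f z

ΣL1 : ℕ → (ℕ → LS) → LS
ΣL1 zero    F z = 0ℚ
ΣL1 (suc n) F z = ΣL1 n F z + F (suc n) z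

-- 1/(e^t - 1)^k  =  t^{-k} · g(t)^{-k}
invExpm1^ : ℕ → LS
invExpm1^ k = t⁻^ k ⊗ (inv₁ g ^ₚ k)

_⊘expm1^_ : PS → ℕ → LS
F ⊘expm1^ k = t⁻^ k ⊗ (F ⊛ (inv₁ g ^ₚ k))

LHS : ℕ → LS
LHS p = ps→ls (λ n → Bp n p * inv! n)

RHS : ℕ → LS
RHS p =
  (ℕ→ℚ (suc p) ·ₗ (((X ⊕ const (- H p)) ⊛ expPS p) ⊘expm1^ suc p))
  ⊕ₗ (ℕ→ℚ (suc p) ·ₗ ΣL1 p (λ k → (ℕ→ℚ (p C k) * H k) ·ₗ invExpm1^ (suc k)))

module Submission where

-- Put u = e^t - 1.  Since e^t = 1 + u, d/dt acts on Σ a_m u^m as (1 + u) d/du,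
-- i.e. on coefficient sequences as  𝒟 a m = (m+1) a_{m+1} + m a_m.  The left-hand
-- side is L = Σ_m c_m (-u)^m with c_m the coefficients of ₂F₁(1,1;p+2;·); their
-- recurrence (m+p+2) c_{m+1} = (m+1) c_m makes Y = u^{p+1} L a solution of
--   y' = p y + (p+1) u^p,   y(0) = 0.
-- The numerator Z = (p+1) [(t - H_p) e^{pt} + Σ_j C(p,j) H_{p-j} u^j] of the right-hand
-- side solves the same problem (via e^{pt} = Σ_j C(p,j) u^j, binomial absorption and
-- H_{k+1} = H_k + 1/(k+1)), and such solutions are unique, so Y = Z.  Dividing by
-- u^{p+1} = t^{p+1} g^{p+1}, g = (e^t - 1)/t invertible, gives the Laurent identity.

open import Defs
open import Data.Nat using (ℕ)
open import Data.Integer using (ℤ)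
open import Relation.Binary.PropositionalEquality using (_≡_)

open import Data.Nat as ℕ using (zero; suc; _!; z≤n; s≤s; _∸_)
import Data.Nat.Properties as ℕP
open import Data.Nat.Combinatorics using (_C_; nCn≡1; nCk≡nC[n∸k]; nC1≡n; nCk+nC[k+1]≡[n+1]C[k+1])
open import Data.Nat.Combinatorics.Specification using (k>n⇒nCk≡0)
import Data.Nat.Solver as ℕSolver
open import Data.Integer as ℤ using (-[1+_]) renaming (+_ to pos)
import Data.Integer.Properties as ℤP
open import Data.Integer.Tactic.RingSolver using (solve-∀)
open import Data.Rational using (ℚ; _/_; _+_; _*_; -_; 0ℚ; 1ℚ; toℚᵘ)
open import Data.Rational.Properties
import Data.Rational.Unnormalised as U
import Data.Rational.Unnormalised.Properties as UP
open import Data.Rational.Solver using (module +-*-Solver)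
open +-*-Solver using (solve; _:+_; _:*_; :-_; _:=_; con)
open import Data.Vec using (_∷_; tabulate; zipWith; foldr)
open import Data.Fin using (Fin; toℕ)
import Data.Fin as Fin
open import Data.Product using (_,_)
open import Relation.Nullary using (yes; no)
open import Relation.Binary using (tri<; tri≈; tri>)
open import Relation.Binary.PropositionalEquality using (refl; sym; trans; cong; cong₂; subst; module ≡-Reasoning)

/-toℚᵘ : ∀ i k → toℚᵘ (i / suc k) U.≃ U.mkℚᵘ i k
/-toℚᵘ i k = toℚᵘ-fromℚᵘ (U.mkℚᵘ i k)

-- ℕ→ℚ is a semiring homomorphism; both facts are checked on unnormalised
-- rationals, where they are integer identities.
ℕ→ℚ-+ : ∀ a b → ℕ→ℚ (a ℕ.+ b) ≡ ℕ→ℚ a + ℕ→ℚ b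
ℕ→ℚ-+ a b = toℚᵘ-injective (UP.≃-trans (/-toℚᵘ (pos (a ℕ.+ b)) 0)
  (UP.≃-trans (U.*≡* integral)
  (UP.≃-trans (UP.+-cong (UP.≃-sym (/-toℚᵘ (pos a) 0)) (UP.≃-sym (/-toℚᵘ (pos b) 0)))
  (UP.≃-sym (toℚᵘ-homo-+ (ℕ→ℚ a) (ℕ→ℚ b))))))
  where
  shape : ∀ (x y : ℤ) → (x ℤ.+ y) ℤ.* ℤ.+ 1 ≡ (x ℤ.* ℤ.+ 1 ℤ.+ y ℤ.* ℤ.+ 1) ℤ.* ℤ.+ 1
  shape = solve-∀
  integral : pos (a ℕ.+ b) ℤ.* ℤ.+ 1 ≡ (pos a ℤ.* ℤ.+ 1 ℤ.+ pos b ℤ.* ℤ.+ 1) ℤ.* ℤ.+ 1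
  integral = trans (cong (ℤ._* ℤ.+ 1) (ℤP.pos-+ a b)) (shape (pos a) (pos b))

ℕ→ℚ-* : ∀ a b → ℕ→ℚ (a ℕ.* b) ≡ ℕ→ℚ a * ℕ→ℚ b
ℕ→ℚ-* a b = toℚᵘ-injective (UP.≃-trans (/-toℚᵘ (pos (a ℕ.* b)) 0)
  (UP.≃-trans (U.*≡* (cong (ℤ._* ℤ.+ 1) (ℤP.pos-* a b)))
  (UP.≃-trans (UP.*-cong (UP.≃-sym (/-toℚᵘ (pos a) 0)) (UP.≃-sym (/-toℚᵘ (pos b) 0)))
  (UP.≃-sym (toℚᵘ-homo-* (ℕ→ℚ a) (ℕ→ℚ b))))))

ℕ→ℚ-suc : ∀ n → ℕ→ℚ (suc n) ≡ ℕ→ℚ n + 1ℚ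
ℕ→ℚ-suc n = trans (cong ℕ→ℚ (ℕP.+-comm 1 n)) (ℕ→ℚ-+ n 1)

*-cancel-/ : ∀ a k → ℕ→ℚ (suc k) * (pos a / suc k) ≡ ℕ→ℚ a
*-cancel-/ a k = toℚᵘ-injective (UP.≃-trans (toℚᵘ-homo-* (ℕ→ℚ (suc k)) (pos a / suc k))
  (UP.≃-trans (UP.*-cong (/-toℚᵘ (pos (suc k)) 0) (/-toℚᵘ (pos a) k))
  (UP.≃-trans (U.*≡* integral) (UP.≃-sym (/-toℚᵘ (pos a) 0)))))
  where
  shape : ∀ (x y : ℤ) → (x ℤ.* y) ℤ.* ℤ.+ 1 ≡ y ℤ.* x
  shape = solve-∀
  integral : (pos (suc k) ℤ.* pos a) ℤ.* ℤ.+ 1 ≡ pos a ℤ.* pos (1 ℕ.* suc k)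
  integral = trans (shape (pos (suc k)) (pos a)) (cong (λ d → pos a ℤ.* pos d) (sym (ℕP.*-identityˡ (suc k))))

*-cancelˡ-suc : ∀ n x y → ℕ→ℚ (suc n) * x ≡ ℕ→ℚ (suc n) * y → x ≡ y
*-cancelˡ-suc n x y eq = begin
    x                  ≡⟨ sym (*-identityˡ x) ⟩
    1ℚ * x             ≡⟨ cong (_* x) (sym inverse) ⟩
    r * N * x          ≡⟨ *-assoc r N x ⟩
    r * (N * x)        ≡⟨ cong (r *_) eq ⟩
    r * (N * y)        ≡⟨ sym (*-assoc r N y) ⟩
    r * N * y          ≡⟨ cong (_* y) inverse ⟩
    1ℚ * y             ≡⟨ *-identityˡ y ⟩
    y                  ∎
  where
  open ≡-Reasoning
  N = ℕ→ℚ (suc n)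
  r = pos 1 / suc n
  inverse : r * N ≡ 1ℚ
  inverse = trans (*-comm r N) (*-cancel-/ 1 n)

/-self : ∀ k → pos (suc k) / suc k ≡ 1ℚ
/-self k = *-cancelˡ-suc k _ _ (trans (*-cancel-/ (suc k) k) (sym (*-identityʳ (ℕ→ℚ (suc k)))))

!-inverse : ∀ n → ℕ→ℚ (n !) * inv! n ≡ 1ℚ
!-inverse n = helper (n !) {{n ℕP.!≢0}}
  where
  helper : ∀ d {{_ : ℕ.NonZero d}} → ℕ→ℚ d * (pos 1 / d) ≡ 1ℚ
  helper (suc k) = *-cancel-/ 1 k

-- (n+1) · 1/(n+1)! = 1/n!: the coefficient identity behind (e^t)' = e^t.
inv!-suc : ∀ n → ℕ→ℚ (suc n) * inv! (suc n) ≡ inv! n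
inv!-suc n = begin
    S * I                           ≡⟨ sym (*-identityˡ (S * I)) ⟩
    1ℚ * (S * I)                    ≡⟨ cong (_* (S * I)) (sym (trans (*-comm (inv! n) F) (!-inverse n))) ⟩
    (inv! n * F) * (S * I)          ≡⟨ regroup (inv! n) S F I ⟩
    inv! n * ((S * F) * I)          ≡⟨ cong (λ x → inv! n * (x * I)) (sym (ℕ→ℚ-* (suc n) (n !))) ⟩
    inv! n * (ℕ→ℚ (suc n !) * I)    ≡⟨ cong (inv! n *_) (!-inverse (suc n)) ⟩
    inv! n * 1ℚ                     ≡⟨ *-identityʳ (inv! n) ⟩
    inv! n                          ∎
  where
  open ≡-Reasoning
  S = ℕ→ℚ (suc n)
  F = ℕ→ℚ (n !)
  I = inv! (suc n)
  regroup : ∀ a b c d → (a * c) * (b * d) ≡ a * ((b * c) * d)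
  regroup = solve 4 (λ a b c d → (a :* c) :* (b :* d) := a :* ((b :* c) :* d)) refl

Σ-cong≤ : ∀ n {f h : ℕ → ℚ} → (∀ i → i ℕ.≤ n → f i ≡ h i) → Σ0 n f ≡ Σ0 n h
Σ-cong≤ zero    e = e 0 z≤n
Σ-cong≤ (suc n) e = cong₂ _+_ (Σ-cong≤ n (λ i le → e i (ℕP.m≤n⇒m≤1+n le))) (e (suc n) ℕP.≤-refl)

Σ-cong : ∀ n {f h : ℕ → ℚ} → (∀ i → f i ≡ h i) → Σ0 n f ≡ Σ0 n h
Σ-cong n e = Σ-cong≤ n (λ i _ → e i)

Σ-+ : ∀ n (f h : ℕ → ℚ) → Σ0 n (λ i → f i + h i) ≡ Σ0 n f + Σ0 n h
Σ-+ zero    f h = refl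
Σ-+ (suc n) f h = trans (cong (_+ (f (suc n) + h (suc n))) (Σ-+ n f h))
  (interchange (Σ0 n f) (Σ0 n h) (f (suc n)) (h (suc n)))
  where
  interchange : ∀ a b c d → (a + b) + (c + d) ≡ (a + c) + (b + d)
  interchange = solve 4 (λ a b c d → (a :+ b) :+ (c :+ d) := (a :+ c) :+ (b :+ d)) refl

Σ-*ˡ : ∀ n c (f : ℕ → ℚ) → c * Σ0 n f ≡ Σ0 n (λ i → c * f i)
Σ-*ˡ zero    c f = refl
Σ-*ˡ (suc n) c f = trans (*-distribˡ-+ c (Σ0 n f) (f (suc n))) (cong (_+ (c * f (suc n))) (Σ-*ˡ n c f))

Σ-*ʳ : ∀ n c (f : ℕ → ℚ) → Σ0 n f * c ≡ Σ0 n (λ i → f i * c)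
Σ-*ʳ n c f = trans (*-comm (Σ0 n f) c) (trans (Σ-*ˡ n c f) (Σ-cong n (λ i → *-comm c (f i))))

Σ-zero : ∀ n (f : ℕ → ℚ) → (∀ i → i ℕ.≤ n → f i ≡ 0ℚ) → Σ0 n f ≡ 0ℚ
Σ-zero n f e = trans (Σ-cong≤ n e) (zeros n)
  where
  zeros : ∀ n → Σ0 n (λ _ → 0ℚ) ≡ 0ℚ
  zeros zero    = refl
  zeros (suc n) = trans (+-identityʳ _) (zeros n)

Σ-head : ∀ n (f : ℕ → ℚ) → Σ0 (suc n) f ≡ f 0 + Σ0 n (λ i → f (suc i))
Σ-head zero    f = refl
Σ-head (suc n) f = trans (cong (_+ f (suc (suc n))) (Σ-head n f)) (+-assoc (f 0) _ _)

Σ0-Σ1 : ∀ n (f : ℕ → ℚ) → Σ0 n f ≡ f 0 + Σ1 n f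
Σ0-Σ1 zero    f = sym (+-identityʳ (f 0))
Σ0-Σ1 (suc n) f = trans (cong (_+ f (suc n)) (Σ0-Σ1 n f)) (+-assoc (f 0) (Σ1 n f) (f (suc n)))

Σ1-cong : ∀ n {f h : ℕ → ℚ} → (∀ i → f i ≡ h i) → Σ1 n f ≡ Σ1 n h
Σ1-cong zero    e = refl
Σ1-cong (suc n) e = cong₂ _+_ (Σ1-cong n e) (e (suc n))

Σ-extend : ∀ n N (f : ℕ → ℚ) → n ℕ.≤ N → (∀ i → n ℕ.< i → f i ≡ 0ℚ) → Σ0 N f ≡ Σ0 n f
Σ-extend n N f le e with ℕP.m≤n⇒∃[o]m+o≡n le
... | k , refl = by-length k
  where
  by-length : ∀ k → Σ0 (n ℕ.+ k) f ≡ Σ0 n f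
  by-length zero    = cong (λ m → Σ0 m f) (ℕP.+-identityʳ n)
  by-length (suc k) rewrite ℕP.+-suc n k =
    trans (cong₂ _+_ (by-length k) (e (suc (n ℕ.+ k)) (s≤s (ℕP.m≤m+n n k)))) (+-identityʳ _)

Σ-swap : ∀ n m (F : ℕ → ℕ → ℚ) → Σ0 n (λ i → Σ0 m (F i)) ≡ Σ0 m (λ j → Σ0 n (λ i → F i j))
Σ-swap zero    m F = refl
Σ-swap (suc n) m F = trans (cong (_+ Σ0 m (F (suc n))) (Σ-swap n m F))
  (sym (Σ-+ m (λ j → Σ0 n (λ i → F i j)) (F (suc n))))

suc-∸ : ∀ n i → i ℕ.≤ n → suc n ∸ i ≡ suc (n ∸ i)
suc-∸ n i le = ℕP.+-∸-assoc 1 le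

Σ-reverse : ∀ n (f : ℕ → ℚ) → Σ0 n f ≡ Σ0 n (λ i → f (n ∸ i))
Σ-reverse zero    f = refl
Σ-reverse (suc n) f = begin
    Σ0 (suc n) f                                ≡⟨ Σ-head n f ⟩
    f 0 + Σ0 n (λ i → f (suc i))                ≡⟨ cong (f 0 +_) (Σ-reverse n (λ i → f (suc i))) ⟩
    f 0 + Σ0 n (λ i → f (suc (n ∸ i)))          ≡⟨ +-comm (f 0) _ ⟩
    Σ0 n (λ i → f (suc (n ∸ i))) + f 0          ≡⟨ cong₂ _+_ (Σ-cong≤ n (λ i le → cong f (sym (suc-∸ n i le))))
                                                              (cong f (sym (ℕP.n∸n≡0 n))) ⟩
    Σ0 (suc n) (λ i → f (suc n ∸ i))            ∎
  where open ≡-Reasoning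

Σ-triangle : ∀ n (F : ℕ → ℕ → ℚ) →
             Σ0 n (λ i → Σ0 i (λ j → F j (i ∸ j))) ≡ Σ0 n (λ j → Σ0 (n ∸ j) (F j))
Σ-triangle zero    F = refl
Σ-triangle (suc n) F = begin
    Σ0 n (λ i → Σ0 i (λ j → F j (i ∸ j))) + (Σ0 n (λ j → F j (suc n ∸ j)) + last)
  ≡⟨ cong₂ (λ a b → a + (b + last)) (Σ-triangle n F) (Σ-cong≤ n (λ j le → cong (F j) (suc-∸ n j le))) ⟩
    Σ0 n (λ j → Σ0 (n ∸ j) (F j)) + (Σ0 n (λ j → F j (suc (n ∸ j))) + last)
  ≡⟨ sym (+-assoc (Σ0 n (λ j → Σ0 (n ∸ j) (F j))) (Σ0 n (λ j → F j (suc (n ∸ j)))) last) ⟩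
    (Σ0 n (λ j → Σ0 (n ∸ j) (F j)) + Σ0 n (λ j → F j (suc (n ∸ j)))) + last
  ≡⟨ cong₂ _+_ (sym (Σ-+ n _ _)) (trans (cong (F (suc n)) (ℕP.n∸n≡0 n)) (cong (λ m → Σ0 m (F (suc n))) (sym (ℕP.n∸n≡0 n)))) ⟩
    Σ0 n (λ j → Σ0 (suc (n ∸ j)) (F j)) + Σ0 (n ∸ n) (F (suc n))
  ≡⟨ cong (_+ Σ0 (n ∸ n) (F (suc n))) (Σ-cong≤ n (λ j le → cong (λ m → Σ0 m (F j)) (sym (suc-∸ n j le)))) ⟩
    Σ0 (suc n) (λ j → Σ0 (suc n ∸ j) (F j))
  ∎
  where
  open ≡-Reasoning
  last = F (suc n) (n ∸ n)

infix 4 _≈_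
_≈_ : PS → PS → Set
f ≈ h = ∀ n → f n ≡ h n

≈-sym : ∀ {f h} → f ≈ h → h ≈ f
≈-sym e n = sym (e n)

≈-trans : ∀ {f h k} → f ≈ h → h ≈ k → f ≈ k
≈-trans e₁ e₂ n = trans (e₁ n) (e₂ n)

⊛-cong : ∀ {f f' h h'} → f ≈ f' → h ≈ h' → f ⊛ h ≈ f' ⊛ h'
⊛-cong e₁ e₂ n = Σ-cong n (λ i → cong₂ _*_ (e₁ i) (e₂ (n ∸ i)))

⊛-congʳ : ∀ f {h h'} → h ≈ h' → f ⊛ h ≈ f ⊛ h'
⊛-congʳ f e = ⊛-cong {f} {f} (λ _ → refl) e

⊛-congˡ : ∀ {f f'} h → f ≈ f' → f ⊛ h ≈ f' ⊛ h
⊛-congˡ {f} {f'} h e = ⊛-cong {f} {f'} {h} {h} e (λ _ → refl)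

·-cong : ∀ c {f f'} → f ≈ f' → c · f ≈ c · f'
·-cong c e n = cong (c *_) (e n)

⊛-comm : ∀ f h → f ⊛ h ≈ h ⊛ f
⊛-comm f h n = trans (Σ-reverse n (λ i → f i * h (n ∸ i)))
  (Σ-cong≤ n (λ i le → trans (cong (λ m → f (n ∸ i) * h m) (ℕP.m∸[m∸n]≡n le)) (*-comm (f (n ∸ i)) (h i))))

⊛-assoc : ∀ f h k → (f ⊛ h) ⊛ k ≈ f ⊛ (h ⊛ k)
⊛-assoc f h k n = begin
    Σ0 n (λ i → Σ0 i (λ j → f j * h (i ∸ j)) * k (n ∸ i))
  ≡⟨ Σ-cong n (λ i → Σ-*ʳ i (k (n ∸ i)) (λ j → f j * h (i ∸ j))) ⟩
    Σ0 n (λ i → Σ0 i (λ j → f j * h (i ∸ j) * k (n ∸ i)))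
  ≡⟨ Σ-cong≤ n (λ i _ → Σ-cong≤ i (λ j j≤i → cong (λ m → f j * h (i ∸ j) * k m) (remaining i j j≤i))) ⟩
    Σ0 n (λ i → Σ0 i (λ j → F j (i ∸ j)))
  ≡⟨ Σ-triangle n F ⟩
    Σ0 n (λ j → Σ0 (n ∸ j) (F j))
  ≡⟨ Σ-cong n (λ j → trans (Σ-cong (n ∸ j) (λ a → *-assoc (f j) (h a) (k (n ∸ j ∸ a))))
                            (sym (Σ-*ˡ (n ∸ j) (f j) (λ a → h a * k (n ∸ j ∸ a))))) ⟩
    Σ0 n (λ j → f j * (h ⊛ k) (n ∸ j))
  ∎
  where
  open ≡-Reasoning
  F : ℕ → ℕ → ℚ
  F j a = f j * h a * k (n ∸ j ∸ a)
  remaining : ∀ i j → j ℕ.≤ i → n ∸ i ≡ n ∸ j ∸ (i ∸ j)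
  remaining i j j≤i = trans (cong (n ∸_) (sym (ℕP.m+[n∸m]≡n j≤i))) (sym (ℕP.∸-+-assoc n j (i ∸ j)))

⊛-distribʳ : ∀ f h k → (f ⊕ h) ⊛ k ≈ (f ⊛ k) ⊕ (h ⊛ k)
⊛-distribʳ f h k n = trans (Σ-cong n (λ i → *-distribʳ-+ (k (n ∸ i)) (f i) (h i))) (Σ-+ n _ _)

⊛-distribˡ : ∀ f h k → f ⊛ (h ⊕ k) ≈ (f ⊛ h) ⊕ (f ⊛ k)
⊛-distribˡ f h k n = trans (Σ-cong n (λ i → *-distribˡ-+ (f i) (h (n ∸ i)) (k (n ∸ i)))) (Σ-+ n _ _)

⊛-scalˡ : ∀ c f h → (c · f) ⊛ h ≈ c · (f ⊛ h)
⊛-scalˡ c f h n = trans (Σ-cong n (λ i → *-assoc c (f i) (h (n ∸ i)))) (sym (Σ-*ˡ n c _))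

⊛-scalʳ : ∀ c f h → f ⊛ (c · h) ≈ c · (f ⊛ h)
⊛-scalʳ c f h = ≈-trans (⊛-comm f (c · h)) (≈-trans (⊛-scalˡ c h f) (·-cong c (⊛-comm h f)))

⊛-identityˡ : ∀ f → one ⊛ f ≈ f
⊛-identityˡ f zero    = *-identityˡ (f 0)
⊛-identityˡ f (suc n) = trans (Σ-head n (λ i → one i * f (suc n ∸ i)))
  (trans (cong₂ _+_ (*-identityˡ (f (suc n))) (Σ-zero n _ (λ i _ → *-zeroˡ (f (n ∸ i)))))
         (+-identityʳ (f (suc n))))

⊛-identityʳ : ∀ f → f ⊛ one ≈ f
⊛-identityʳ f = ≈-trans (⊛-comm f one) (⊛-identityˡ f)

⊛-interchange : ∀ f h f' h' → (f ⊛ h) ⊛ (f' ⊛ h') ≈ (f ⊛ f') ⊛ (h ⊛ h')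
⊛-interchange f h f' h' =
  ≈-trans (⊛-assoc f h (f' ⊛ h'))
  (≈-trans (⊛-congʳ f (≈-trans (≈-sym (⊛-assoc h f' h'))
                      (≈-trans (⊛-congˡ h' (⊛-comm h f')) (⊛-assoc f' h h'))))
  (≈-sym (⊛-assoc f f' (h ⊛ h'))))

Σ-⊛ : ∀ p (c : ℕ → ℚ) (F : ℕ → PS) h →
      (λ n → Σ0 p (λ j → c j * F j n)) ⊛ h ≈ (λ n → Σ0 p (λ j → c j * (F j ⊛ h) n))
Σ-⊛ p c F h n = begin
    Σ0 n (λ i → Σ0 p (λ j → c j * F j i) * h (n ∸ i))
  ≡⟨ Σ-cong n (λ i → trans (Σ-*ʳ p (h (n ∸ i)) _) (Σ-cong p (λ j → *-assoc (c j) (F j i) (h (n ∸ i))))) ⟩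
    Σ0 n (λ i → Σ0 p (λ j → c j * (F j i * h (n ∸ i))))
  ≡⟨ Σ-swap n p _ ⟩
    Σ0 p (λ j → Σ0 n (λ i → c j * (F j i * h (n ∸ i))))
  ≡⟨ Σ-cong p (λ j → sym (Σ-*ˡ n (c j) _)) ⟩
    Σ0 p (λ j → c j * (F j ⊛ h) n)
  ∎
  where open ≡-Reasoning

^-cong : ∀ {f f'} → f ≈ f' → ∀ m → f ^ₚ m ≈ f' ^ₚ m
^-cong e zero    n = refl
^-cong {f} {f'} e (suc m) = ⊛-cong {f} {f'} {f ^ₚ m} {f' ^ₚ m} e (^-cong e m)

^-+ : ∀ f a b → f ^ₚ (a ℕ.+ b) ≈ (f ^ₚ a) ⊛ (f ^ₚ b)
^-+ f zero    b = ≈-sym (⊛-identityˡ (f ^ₚ b))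
^-+ f (suc a) b = ≈-trans (⊛-congʳ f (^-+ f a b)) (≈-sym (⊛-assoc f (f ^ₚ a) (f ^ₚ b)))

^-⊛ : ∀ f h m → (f ⊛ h) ^ₚ m ≈ (f ^ₚ m) ⊛ (h ^ₚ m)
^-⊛ f h zero    = ≈-sym (⊛-identityˡ one)
^-⊛ f h (suc m) = ≈-trans (⊛-congʳ (f ⊛ h) (^-⊛ f h m)) (⊛-interchange f h (f ^ₚ m) (h ^ₚ m))

one-^ : ∀ m → one ^ₚ m ≈ one
one-^ zero    n = refl
one-^ (suc m) = ≈-trans (⊛-identityˡ (one ^ₚ m)) (one-^ m)

-- Order: f has no terms of degree < k.  Powers of a series without constant
-- term vanish in low degree, which makes composition a finite sum.
HasOrder : ℕ → PS → Set
HasOrder k f = ∀ n → n ℕ.< k → f n ≡ 0ℚ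

∸-<-split : ∀ {i n} b → i ℕ.≤ n → n ℕ.< i ℕ.+ b → n ∸ i ℕ.< b
∸-<-split b z≤n      lt       = lt
∸-<-split b (s≤s le) (s≤s lt) = ∸-<-split b le lt

order-⊛ : ∀ a b f h → HasOrder a f → HasOrder b h → HasOrder (a ℕ.+ b) (f ⊛ h)
order-⊛ a b f h of oh n lt = Σ-zero n _ term
  where
  term : ∀ i → i ℕ.≤ n → f i * h (n ∸ i) ≡ 0ℚ
  term i le with i ℕP.<? a
  ... | yes i<a = trans (cong (_* h (n ∸ i)) (of i i<a)) (*-zeroˡ (h (n ∸ i)))
  ... | no  i≮a = trans (cong (f i *_) (oh (n ∸ i) (∸-<-split b le (ℕP.<-≤-trans lt (ℕP.+-monoˡ-≤ b (ℕP.≮⇒≥ i≮a))))))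
                        (*-zeroʳ (f i))

order-^ : ∀ f → HasOrder 1 f → ∀ m → HasOrder m (f ^ₚ m)
order-^ f o zero    n ()
order-^ f o (suc m) = order-⊛ 1 m f (f ^ₚ m) o (order-^ f o m)

-- The formal derivative

D : PS → PS
D f n = ℕ→ℚ (suc n) * f (suc n)

D-cong : ∀ {f h} → f ≈ h → D f ≈ D h
D-cong e n = cong (ℕ→ℚ (suc n) *_) (e (suc n))

D-⊕ : ∀ f h → D (f ⊕ h) ≈ D f ⊕ D h
D-⊕ f h n = *-distribˡ-+ (ℕ→ℚ (suc n)) (f (suc n)) (h (suc n))

D-· : ∀ c f → D (c · f) ≈ c · D f
D-· c f n = trans (sym (*-assoc (ℕ→ℚ (suc n)) c (f (suc n))))
  (trans (cong (_* f (suc n)) (*-comm (ℕ→ℚ (suc n)) c)) (*-assoc c (ℕ→ℚ (suc n)) (f (suc n))))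

-- Leibniz rule: the weight n+1 of each term f_i h_{n+1-i} splits as i + (n+1-i).
D-⊛ : ∀ f h → D (f ⊛ h) ≈ (D f ⊛ h) ⊕ (f ⊛ D h)
D-⊛ f h n = begin
    ℕ→ℚ (suc n) * Σ0 (suc n) T
  ≡⟨ trans (Σ-*ˡ (suc n) (ℕ→ℚ (suc n)) T) (Σ-cong≤ (suc n) split) ⟩
    Σ0 (suc n) (λ i → ℕ→ℚ i * T i + ℕ→ℚ (suc n ∸ i) * T i)
  ≡⟨ Σ-+ (suc n) _ _ ⟩
    Σ0 (suc n) (λ i → ℕ→ℚ i * T i) + Σ0 (suc n) (λ i → ℕ→ℚ (suc n ∸ i) * T i)
  ≡⟨ cong₂ _+_ firstTermVanishes lastTermVanishes ⟩
    Σ0 n (λ i → ℕ→ℚ (suc i) * T (suc i)) + Σ0 n (λ i → ℕ→ℚ (suc n ∸ i) * T i)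
  ≡⟨ cong₂ _+_ (Σ-cong n (λ i → sym (*-assoc (ℕ→ℚ (suc i)) (f (suc i)) (h (n ∸ i)))))
               (Σ-cong≤ n (λ i le → trans (cong (λ m → ℕ→ℚ m * (f i * h m)) (suc-∸ n i le))
                                          (swap (ℕ→ℚ (suc (n ∸ i))) (f i) (h (suc (n ∸ i)))))) ⟩
    (D f ⊛ h) n + (f ⊛ D h) n
  ∎
  where
  open ≡-Reasoning
  T : ℕ → ℚ
  T i = f i * h (suc n ∸ i)
  split : ∀ i → i ℕ.≤ suc n → ℕ→ℚ (suc n) * T i ≡ ℕ→ℚ i * T i + ℕ→ℚ (suc n ∸ i) * T i
  split i le = trans (cong (λ m → ℕ→ℚ m * T i) (sym (ℕP.m+[n∸m]≡n le)))
    (trans (cong (_* T i) (ℕ→ℚ-+ i (suc n ∸ i))) (*-distribʳ-+ (T i) (ℕ→ℚ i) (ℕ→ℚ (suc n ∸ i))))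
  firstTermVanishes : Σ0 (suc n) (λ i → ℕ→ℚ i * T i) ≡ Σ0 n (λ i → ℕ→ℚ (suc i) * T (suc i))
  firstTermVanishes = trans (Σ-head n (λ i → ℕ→ℚ i * T i))
    (trans (cong (_+ rest) (*-zeroˡ (T 0))) (+-identityˡ rest))
    where rest = Σ0 n (λ i → ℕ→ℚ (suc i) * T (suc i))
  lastTermVanishes : Σ0 (suc n) (λ i → ℕ→ℚ (suc n ∸ i) * T i) ≡ Σ0 n (λ i → ℕ→ℚ (suc n ∸ i) * T i)
  lastTermVanishes = trans (cong (rest +_) (trans (cong (λ m → ℕ→ℚ m * T (suc n)) (ℕP.n∸n≡0 n)) (*-zeroˡ (T (suc n)))))
    (+-identityʳ rest)
    where rest = Σ0 n (λ i → ℕ→ℚ (suc n ∸ i) * T i)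
  swap : ∀ a b c → a * (b * c) ≡ b * (a * c)
  swap = solve 3 (λ a b c → a :* (b :* c) := b :* (a :* c)) refl

-- A solution of y' = c y + h is determined by its constant term, since the
-- equation fixes (n+1) y_{n+1} from y_n.
ode-unique : ∀ f f' c (h : PS) → (∀ n → D f n ≡ c * f n + h n) → (∀ n → D f' n ≡ c * f' n + h n) →
             f 0 ≡ f' 0 → f ≈ f'
ode-unique f f' c h df df' e₀ zero    = e₀
ode-unique f f' c h df df' e₀ (suc n) = *-cancelˡ-suc n (f (suc n)) (f' (suc n))
  (trans (df n) (trans (cong (λ x → c * x + h n) (ode-unique f f' c h df df' e₀ n)) (sym (df' n))))

u : PS
u = expm1

u-order : HasOrder 1 u
u-order zero    _        = refl
u-order (suc n) (s≤s ())

u^-order : ∀ m → HasOrder m (u ^ₚ m)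
u^-order = order-^ u u-order

D-u : D u ≈ one ⊕ u
D-u zero    = trans (inv!-suc 0) (sym (+-identityʳ 1ℚ))
D-u (suc n) = trans (inv!-suc (suc n)) (sym (+-identityˡ (inv! (suc n))))

D-exp : ∀ p → D (expPS p) ≈ ℕ→ℚ p · expPS p
D-exp p n = begin
    ℕ→ℚ (suc n) * (ℕ→ℚ (p ℕ.* p ℕ.^ n) * inv! (suc n))
  ≡⟨ cong (λ x → ℕ→ℚ (suc n) * (x * inv! (suc n))) (ℕ→ℚ-* p (p ℕ.^ n)) ⟩
    ℕ→ℚ (suc n) * ((ℕ→ℚ p * ℕ→ℚ (p ℕ.^ n)) * inv! (suc n))
  ≡⟨ regroup (ℕ→ℚ (suc n)) (ℕ→ℚ p) (ℕ→ℚ (p ℕ.^ n)) (inv! (suc n)) ⟩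
    ℕ→ℚ p * (ℕ→ℚ (p ℕ.^ n) * (ℕ→ℚ (suc n) * inv! (suc n)))
  ≡⟨ cong (λ x → ℕ→ℚ p * (ℕ→ℚ (p ℕ.^ n) * x)) (inv!-suc n) ⟩
    ℕ→ℚ p * (ℕ→ℚ (p ℕ.^ n) * inv! n)
  ∎
  where
  open ≡-Reasoning
  regroup : ∀ a b c d → a * ((b * c) * d) ≡ b * (c * (a * d))
  regroup = solve 4 (λ a b c d → a :* ((b :* c) :* d) := b :* (c :* (a :* d))) refl

D-u^suc : ∀ m → D (u ^ₚ suc m) ≈ ℕ→ℚ (suc m) · ((u ^ₚ m) ⊕ (u ^ₚ suc m))
D-u^suc zero n = begin
    D (u ⊛ one) n            ≡⟨ D-cong (⊛-identityʳ u) n ⟩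
    D u n                    ≡⟨ D-u n ⟩
    one n + u n              ≡⟨ cong (one n +_) (sym (⊛-identityʳ u n)) ⟩
    one n + (u ⊛ one) n      ≡⟨ sym (*-identityˡ _) ⟩
    1ℚ * (one n + (u ⊛ one) n) ∎
  where open ≡-Reasoning
D-u^suc (suc m) n = begin
    D (u ⊛ (u ^ₚ suc m)) n
  ≡⟨ D-⊛ u (u ^ₚ suc m) n ⟩
    (D u ⊛ (u ^ₚ suc m)) n + (u ⊛ D (u ^ₚ suc m)) n
  ≡⟨ cong₂ _+_ (trans (⊛-congˡ (u ^ₚ suc m) D-u n)
                      (trans (⊛-distribʳ one u (u ^ₚ suc m) n) (cong (_+ B) (⊛-identityˡ (u ^ₚ suc m) n))))
               (trans (⊛-congʳ u (D-u^suc m) n)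
                      (trans (⊛-scalʳ c u ((u ^ₚ m) ⊕ (u ^ₚ suc m)) n) (cong (c *_) (⊛-distribˡ u (u ^ₚ m) (u ^ₚ suc m) n)))) ⟩
    (A + B) + c * (A + B)
  ≡⟨ collect c (A + B) ⟩
    (c + 1ℚ) * (A + B)
  ≡⟨ cong (_* (A + B)) (sym (ℕ→ℚ-suc (suc m))) ⟩
    ℕ→ℚ (suc (suc m)) * (A + B)
  ∎
  where
  open ≡-Reasoning
  c = ℕ→ℚ (suc m)
  A = (u ^ₚ suc m) n
  B = (u ^ₚ suc (suc m)) n
  collect : ∀ c x → x + c * x ≡ (c + 1ℚ) * x
  collect = solve 2 (λ c x → x :+ c :* x := (c :+ con 1ℚ) :* x) refl

-- Composition with u: Φ a = Σ_m a_m u^m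

Φ : (ℕ → ℚ) → PS
Φ a = compose a u

Φ-cong : ∀ {a b} → (∀ m → a m ≡ b m) → Φ a ≈ Φ b
Φ-cong e n = Σ-cong n (λ m → cong (_* (u ^ₚ m) n) (e m))

-- The coefficient of t^n involves only u^m with m ≤ n; any longer range works.
Φ-extend : ∀ a n N → n ℕ.≤ N → Φ a n ≡ Σ0 N (λ m → a m * (u ^ₚ m) n)
Φ-extend a n N le = sym (Σ-extend n N _ le (λ i lt → trans (cong (a i *_) (u^-order i n lt)) (*-zeroʳ (a i))))

Φ-⊕ : ∀ a b → Φ (a ⊕ b) ≈ Φ a ⊕ Φ b
Φ-⊕ a b n = trans (Σ-cong n (λ m → *-distribʳ-+ ((u ^ₚ m) n) (a m) (b m))) (Σ-+ n _ _)

Φ-· : ∀ c a → Φ (c · a) ≈ c · Φ a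
Φ-· c a n = trans (Σ-cong n (λ m → *-assoc c (a m) ((u ^ₚ m) n))) (sym (Σ-*ˡ n c _))

Φ-one : Φ one ≈ one
Φ-one zero    = *-identityˡ 1ℚ
Φ-one (suc n) = trans (Σ-head n (λ m → one m * (u ^ₚ m) (suc n)))
  (trans (cong₂ _+_ (*-identityˡ 0ℚ) (Σ-zero n _ (λ i _ → *-zeroˡ ((u ^ₚ suc i) (suc n))))) (+-identityˡ 0ℚ))

u-⊛-Φ : ∀ a n → (u ⊛ Φ a) n ≡ Σ0 n (λ m → a m * (u ^ₚ suc m) n)
u-⊛-Φ a n = begin
    Σ0 n (λ i → u i * Φ a (n ∸ i))
  ≡⟨ Σ-cong n (λ i → cong (u i *_) (Φ-extend a (n ∸ i) n (ℕP.m∸n≤m n i))) ⟩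
    Σ0 n (λ i → u i * Σ0 n (λ m → a m * (u ^ₚ m) (n ∸ i)))
  ≡⟨ Σ-cong n (λ i → trans (Σ-*ˡ n (u i) _) (Σ-cong n (λ m → swap (u i) (a m) ((u ^ₚ m) (n ∸ i))))) ⟩
    Σ0 n (λ i → Σ0 n (λ m → a m * (u i * (u ^ₚ m) (n ∸ i))))
  ≡⟨ Σ-swap n n _ ⟩
    Σ0 n (λ m → Σ0 n (λ i → a m * (u i * (u ^ₚ m) (n ∸ i))))
  ≡⟨ Σ-cong n (λ m → sym (Σ-*ˡ n (a m) _)) ⟩
    Σ0 n (λ m → a m * (u ^ₚ suc m) n)
  ∎
  where
  open ≡-Reasoning
  swap : ∀ x y z → x * (y * z) ≡ y * (x * z)
  swap = solve 3 (λ x y z → x :* (y :* z) := y :* (x :* z)) refl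

shift : (ℕ → ℚ) → (ℕ → ℚ)
shift a zero    = 0ℚ
shift a (suc m) = a m

Φ-shift : ∀ a → u ⊛ Φ a ≈ Φ (shift a)
Φ-shift a n = begin
    (u ⊛ Φ a) n                                     ≡⟨ u-⊛-Φ a n ⟩
    R                                               ≡⟨ sym (+-identityˡ R) ⟩
    0ℚ + R                                          ≡⟨ cong (_+ R) (sym (*-zeroˡ (one n))) ⟩
    0ℚ * one n + R                                  ≡⟨ sym (Σ-head n (λ m → shift a m * (u ^ₚ m) n)) ⟩
    Σ0 (suc n) (λ m → shift a m * (u ^ₚ m) n)       ≡⟨ sym (Φ-extend (shift a) n (suc n) (ℕP.n≤1+n n)) ⟩
    Φ (shift a) n                                   ∎
  where
  open ≡-Reasoning
  R = Σ0 n (λ m → a m * (u ^ₚ suc m) n)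

shiftBy : ℕ → (ℕ → ℚ) → ℕ → ℚ
shiftBy zero    a = a
shiftBy (suc j) a = shift (shiftBy j a)

shiftBy-below : ∀ j a m → m ℕ.< j → shiftBy j a m ≡ 0ℚ
shiftBy-below (suc j) a zero    lt       = refl
shiftBy-below (suc j) a (suc m) (s≤s lt) = shiftBy-below j a m lt

shiftBy-at : ∀ j a → shiftBy j a j ≡ a 0
shiftBy-at zero    a = refl
shiftBy-at (suc j) a = shiftBy-at j a

shiftBy-above : ∀ j a k → shiftBy j a (j ℕ.+ k) ≡ a k
shiftBy-above zero    a k = refl
shiftBy-above (suc j) a k = shiftBy-above j a k

Φ-shiftBy : ∀ j a → (u ^ₚ j) ⊛ Φ a ≈ Φ (shiftBy j a)
Φ-shiftBy zero    a = ⊛-identityˡ (Φ a)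
Φ-shiftBy (suc j) a =
  ≈-trans (⊛-assoc u (u ^ₚ j) (Φ a)) (≈-trans (⊛-congʳ u (Φ-shiftBy j a)) (Φ-shift (shiftBy j a)))

Φ-unit : ∀ p → Φ (shiftBy p one) ≈ u ^ₚ p
Φ-unit p n = trans (sym (Φ-shiftBy p one n)) (trans (⊛-congʳ (u ^ₚ p) Φ-one n) (⊛-identityʳ (u ^ₚ p) n))

-- The chain rule d/dt = (1 + u) d/du, on coefficient sequences.
𝒟 : (ℕ → ℚ) → ℕ → ℚ
𝒟 a m = D a m + ℕ→ℚ m * a m

-- Differentiating Σ a_m u^m term by term, using (u^{m+1})' = (m+1)(u^m + u^{m+1}).
D-Φ-termwise : ∀ a n → D (Φ a) n ≡ Σ0 n (λ m → D a m * (u ^ₚ m) n + D a m * (u ^ₚ suc m) n)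
D-Φ-termwise a n = begin
    ℕ→ℚ (suc n) * Σ0 (suc n) (λ m → a m * (u ^ₚ m) (suc n))
  ≡⟨ trans (Σ-*ˡ (suc n) (ℕ→ℚ (suc n)) _) (Σ-cong (suc n) (λ m → swap (ℕ→ℚ (suc n)) (a m) ((u ^ₚ m) (suc n)))) ⟩
    Σ0 (suc n) (λ m → a m * D (u ^ₚ m) n)
  ≡⟨ Σ-head n (λ m → a m * D (u ^ₚ m) n) ⟩
    a 0 * D one n + Σ0 n (λ m → a (suc m) * D (u ^ₚ suc m) n)
  ≡⟨ cong₂ _+_ (trans (cong (a 0 *_) (*-zeroʳ (ℕ→ℚ (suc n)))) (*-zeroʳ (a 0)))
               (Σ-cong n (λ m → cong (a (suc m) *_) (D-u^suc m n))) ⟩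
    0ℚ + Σ0 n (λ m → a (suc m) * (ℕ→ℚ (suc m) * ((u ^ₚ m) n + (u ^ₚ suc m) n)))
  ≡⟨ trans (+-identityˡ _) (Σ-cong n (λ m → expand (a (suc m)) (ℕ→ℚ (suc m)) ((u ^ₚ m) n) ((u ^ₚ suc m) n))) ⟩
    Σ0 n (λ m → D a m * (u ^ₚ m) n + D a m * (u ^ₚ suc m) n)
  ∎
  where
  open ≡-Reasoning
  swap : ∀ s x y → s * (x * y) ≡ x * (s * y)
  swap = solve 3 (λ s x y → s :* (x :* y) := x :* (s :* y)) refl
  expand : ∀ x s p q → x * (s * (p + q)) ≡ s * x * p + s * x * q
  expand = solve 4 (λ x s p q → x :* (s :* (p :+ q)) := s :* x :* p :+ s :* x :* q) refl

shift-D : ∀ (a : ℕ → ℚ) m → shift (D a) m ≡ ℕ→ℚ m * a m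
shift-D a zero    = sym (*-zeroˡ (a 0))
shift-D a (suc m) = refl

D-Φ : ∀ a → D (Φ a) ≈ Φ (𝒟 a)
D-Φ a n = begin
    D (Φ a) n
  ≡⟨ trans (D-Φ-termwise a n) (Σ-+ n _ _) ⟩
    Φ (D a) n + Σ0 n (λ m → D a m * (u ^ₚ suc m) n)
  ≡⟨ cong (Φ (D a) n +_) (trans (sym (u-⊛-Φ (D a) n)) (Φ-shift (D a) n)) ⟩
    Φ (D a) n + Φ (shift (D a)) n
  ≡⟨ sym (Φ-⊕ (D a) (shift (D a)) n) ⟩
    Φ (D a ⊕ shift (D a)) n
  ≡⟨ Φ-cong (λ m → cong (D a m +_) (shift-D a m)) n ⟩
    Φ (𝒟 a) n
  ∎
  where open ≡-Reasoning

Φ-ode : ∀ a c b → (∀ m → 𝒟 a m ≡ c * a m + b m) → ∀ n → D (Φ a) n ≡ c * Φ a n + Φ b n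
Φ-ode a c b rec n = begin
    D (Φ a) n                 ≡⟨ D-Φ a n ⟩
    Φ (𝒟 a) n                 ≡⟨ Φ-cong rec n ⟩
    Φ ((c · a) ⊕ b) n         ≡⟨ Φ-⊕ (c · a) b n ⟩
    Φ (c · a) n + Φ b n       ≡⟨ cong (_+ Φ b n) (Φ-· c a n) ⟩
    c * Φ a n + Φ b n         ∎
  where open ≡-Reasoning

-- The inverse of g = (e^t - 1)/t

invVec-tabulate : ∀ f n → invVec f n ≡ tabulate (λ i → inv₁ f (n ∸ toℕ i))
invVec-tabulate f zero    = refl
invVec-tabulate f (suc n) = cong (inv₁ f (suc n) ∷_) (invVec-tabulate f n)

zipWith-tabulate : ∀ n (a b : Fin n → ℚ) → zipWith _*_ (tabulate a) (tabulate b) ≡ tabulate (λ i → a i * b i)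
zipWith-tabulate zero    a b = refl
zipWith-tabulate (suc n) a b =
  cong (a Fin.zero * b Fin.zero ∷_) (zipWith-tabulate n (λ i → a (Fin.suc i)) (λ i → b (Fin.suc i)))

foldr-tabulate : ∀ n (h : ℕ → ℚ) → foldr (λ _ → ℚ) _+_ 0ℚ (tabulate {n = suc n} (λ i → h (toℕ i))) ≡ Σ0 n h
foldr-tabulate zero    h = +-identityʳ (h 0)
foldr-tabulate (suc n) h = trans (cong (h 0 +_) (foldr-tabulate n (λ i → h (suc i)))) (sym (Σ-head n h))

inv₁-suc : ∀ f n → inv₁ f (suc n) ≡ - Σ0 n (λ i → f (suc i) * inv₁ f (n ∸ i))
inv₁-suc f n = cong -_ (trans (cong (foldr (λ _ → ℚ) _+_ 0ℚ)
    (trans (cong (zipWith _*_ (tabulate (λ i → f (suc (toℕ i))))) (invVec-tabulate f n))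
           (zipWith-tabulate (suc n) (λ i → f (suc (toℕ i))) (λ i → inv₁ f (n ∸ toℕ i)))))
  (foldr-tabulate n (λ i → f (suc i) * inv₁ f (n ∸ i))))

inv₁-inverse : ∀ f → f 0 ≡ 1ℚ → f ⊛ inv₁ f ≈ one
inv₁-inverse f f₀ zero    = trans (cong (_* 1ℚ) f₀) (*-identityˡ 1ℚ)
inv₁-inverse f f₀ (suc n) = trans (Σ-head n (λ i → f i * inv₁ f (suc n ∸ i)))
  (trans (cong (_+ rest) (trans (cong₂ _*_ f₀ (inv₁-suc f n)) (*-identityˡ (- rest)))) (+-inverseˡ rest))
  where rest = Σ0 n (λ i → f (suc i) * inv₁ f (n ∸ i))

g⁻¹ : PS
g⁻¹ = inv₁ g

g^-inverse : ∀ m → (g ^ₚ m) ⊛ (g⁻¹ ^ₚ m) ≈ one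
g^-inverse m = ≈-trans (≈-sym (^-⊛ g g⁻¹ m)) (≈-trans (^-cong (inv₁-inverse g refl) m) (one-^ m))

X-⊛-suc : ∀ f n → (X ⊛ f) (suc n) ≡ f n
X-⊛-suc f n = trans (Σ-head n (λ i → X i * f (suc n ∸ i)))
  (trans (cong (_+ Σ0 n (λ i → X (suc i) * f (n ∸ i))) (*-zeroˡ (f (suc n)))) (trans (+-identityˡ _) (picks n)))
  where
  picks : ∀ n → Σ0 n (λ i → X (suc i) * f (n ∸ i)) ≡ f n
  picks zero    = *-identityˡ (f 0)
  picks (suc m) = trans (Σ-head m (λ i → X (suc i) * f (suc m ∸ i)))
    (trans (cong₂ _+_ (*-identityˡ (f (suc m))) (Σ-zero m _ (λ i _ → *-zeroˡ (f (m ∸ i))))) (+-identityʳ (f (suc m))))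

X-⊛-zero : ∀ f → (X ⊛ f) 0 ≡ 0ℚ
X-⊛-zero f = *-zeroˡ (f 0)

u^-factor : ∀ j → u ^ₚ j ≈ (X ^ₚ j) ⊛ (g ^ₚ j)
u^-factor j = ≈-trans (^-cong u≈Xg j) (^-⊛ X g j)
  where
  u≈Xg : u ≈ X ⊛ g
  u≈Xg zero    = sym (X-⊛-zero g)
  u≈Xg (suc n) = sym (X-⊛-suc g n)

u^-⊛-g⁻¹^ : ∀ j m → (u ^ₚ j) ⊛ (g⁻¹ ^ₚ (j ℕ.+ m)) ≈ (X ^ₚ j) ⊛ (g⁻¹ ^ₚ m)
u^-⊛-g⁻¹^ j m =
  ≈-trans (⊛-cong {u ^ₚ j} {(X ^ₚ j) ⊛ (g ^ₚ j)} {g⁻¹ ^ₚ (j ℕ.+ m)} {(g⁻¹ ^ₚ m) ⊛ (g⁻¹ ^ₚ j)}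
                  (u^-factor j) (≈-trans (^-+ g⁻¹ j m) (⊛-comm (g⁻¹ ^ₚ j) (g⁻¹ ^ₚ m))))
  (≈-trans (⊛-interchange (X ^ₚ j) (g ^ₚ j) (g⁻¹ ^ₚ m) (g⁻¹ ^ₚ j))
  (≈-trans (⊛-congʳ ((X ^ₚ j) ⊛ (g⁻¹ ^ₚ m)) (g^-inverse j)) (⊛-identityʳ ((X ^ₚ j) ⊛ (g⁻¹ ^ₚ m)))))

-- Laurent coefficients

ev : ℤ → PS → ℚ
ev (pos n)  f = f n
ev -[1+ _ ] f = 0ℚ

ev-t⁻^ : ∀ k f z → (t⁻^ k ⊗ f) z ≡ ev (z ℤ.+ pos k) f
ev-t⁻^ k f z with z ℤ.+ pos k
... | pos n    = refl
... | -[1+ _ ] = refl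

ev-cong : ∀ w {f h} → f ≈ h → ev w f ≡ ev w h
ev-cong (pos n)  e = e n
ev-cong -[1+ _ ] e = refl

ev-⊕ : ∀ w f h → ev w (f ⊕ h) ≡ ev w f + ev w h
ev-⊕ (pos n)  f h = refl
ev-⊕ -[1+ _ ] f h = sym (+-identityʳ 0ℚ)

ev-· : ∀ w c f → ev w (c · f) ≡ c * ev w f
ev-· (pos n)  c f = refl
ev-· -[1+ _ ] c f = sym (*-zeroʳ c)

ev-Σ : ∀ w p (F : ℕ → PS) → ev w (λ n → Σ0 p (λ j → F j n)) ≡ Σ0 p (λ j → ev w (F j))
ev-Σ (pos n)  p F = refl
ev-Σ -[1+ _ ] p F = sym (Σ-zero p _ (λ _ _ → refl))

ΣL1-coeff : ∀ n (F : ℕ → LS) z → ΣL1 n F z ≡ Σ1 n (λ k → F k z)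
ΣL1-coeff zero    F z = refl
ΣL1-coeff (suc n) F z = cong (_+ F (suc n) z) (ΣL1-coeff n F z)

X^-⊛-above : ∀ j f n → ((X ^ₚ j) ⊛ f) (j ℕ.+ n) ≡ f n
X^-⊛-above zero    f n = ⊛-identityˡ f n
X^-⊛-above (suc j) f n =
  trans (⊛-assoc X (X ^ₚ j) f (suc (j ℕ.+ n))) (trans (X-⊛-suc ((X ^ₚ j) ⊛ f) (j ℕ.+ n)) (X^-⊛-above j f n))

X^-⊛-below : ∀ j f n → n ℕ.< j → ((X ^ₚ j) ⊛ f) n ≡ 0ℚ
X^-⊛-below (suc j) f zero    lt       = trans (⊛-assoc X (X ^ₚ j) f 0) (X-⊛-zero ((X ^ₚ j) ⊛ f))
X^-⊛-below (suc j) f (suc n) (s≤s lt) =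
  trans (⊛-assoc X (X ^ₚ j) f (suc n)) (trans (X-⊛-suc ((X ^ₚ j) ⊛ f) n) (X^-⊛-below j f n lt))

negative-+ : ∀ n j N → -[1+ n ] ℤ.+ pos j ≡ pos N → N ℕ.< j
negative-+ n j N eq = subst (N ℕ.<_) (sym j≡) (ℕP.m<m+n N (s≤s z≤n))
  where
  cancel : ∀ (x y : ℤ) → ((ℤ.- x) ℤ.+ y) ℤ.+ x ≡ y
  cancel = solve-∀
  j≡ : j ≡ N ℕ.+ suc n
  j≡ = ℤP.+-injective (trans (sym (cancel (pos (suc n)) (pos j)))
         (trans (cong (ℤ._+ pos (suc n)) eq) (sym (ℤP.pos-+ N (suc n)))))

ev-X^ : ∀ j f w → ev (w ℤ.+ pos j) ((X ^ₚ j) ⊛ f) ≡ ev w f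
ev-X^ j f (pos n) = trans (cong ((X ^ₚ j) ⊛ f) (ℕP.+-comm n j)) (X^-⊛-above j f n)
ev-X^ j f -[1+ n ] with -[1+ n ] ℤ.+ pos j in eq
... | pos N    = X^-⊛-below j f N (negative-+ n j N eq)
... | -[1+ _ ] = refl

binomial-absorption : ∀ p j → suc j ℕ.* (p C suc j) ℕ.+ j ℕ.* (p C j) ≡ p ℕ.* (p C j)
binomial-absorption zero    zero    = refl
binomial-absorption zero    (suc j) = cong₂ ℕ._+_ (ℕP.*-zeroʳ (suc (suc j))) (ℕP.*-zeroʳ (suc j))
binomial-absorption (suc p) zero    =
  trans (ℕP.+-identityʳ _) (trans (ℕP.*-identityˡ _) (trans (nC1≡n (suc p)) (sym (ℕP.*-identityʳ (suc p)))))
binomial-absorption (suc p) (suc i) = begin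
    suc (suc i) ℕ.* (suc p C suc (suc i)) ℕ.+ suc i ℕ.* (suc p C suc i)
  ≡⟨ cong₂ (λ x y → suc (suc i) ℕ.* x ℕ.+ suc i ℕ.* y) (sym (pascal (suc i))) (sym (pascal i)) ⟩
    suc (suc i) ℕ.* (a₁ ℕ.+ a₂) ℕ.+ suc i ℕ.* (a₀ ℕ.+ a₁)
  ≡⟨ regroup i a₁ a₂ a₀ ⟩
    (suc (suc i) ℕ.* a₂ ℕ.+ suc i ℕ.* a₁) ℕ.+ (suc i ℕ.* a₁ ℕ.+ i ℕ.* a₀) ℕ.+ a₁ ℕ.+ a₀
  ≡⟨ cong₂ (λ x y → x ℕ.+ y ℕ.+ a₁ ℕ.+ a₀) (binomial-absorption p (suc i)) (binomial-absorption p i) ⟩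
    p ℕ.* a₁ ℕ.+ p ℕ.* a₀ ℕ.+ a₁ ℕ.+ a₀
  ≡⟨ collect p a₁ a₀ ⟩
    suc p ℕ.* (a₀ ℕ.+ a₁)
  ≡⟨ cong (suc p ℕ.*_) (pascal i) ⟩
    suc p ℕ.* (suc p C suc i)
  ∎
  where
  open ≡-Reasoning
  open ℕSolver.+-*-Solver using () renaming (solve to ℕsolve; _:+_ to _⊹_; _:*_ to _⊗_; _:=_ to _≐_; con to ℕcon)
  pascal : ∀ k → p C k ℕ.+ p C suc k ≡ suc p C suc k
  pascal = nCk+nC[k+1]≡[n+1]C[k+1] p
  a₁ = p C suc i
  a₂ = p C suc (suc i)
  a₀ = p C i
  regroup : ∀ i a b c → suc (suc i) ℕ.* (a ℕ.+ b) ℕ.+ suc i ℕ.* (c ℕ.+ a)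
                        ≡ (suc (suc i) ℕ.* b ℕ.+ suc i ℕ.* a) ℕ.+ (suc i ℕ.* a ℕ.+ i ℕ.* c) ℕ.+ a ℕ.+ c
  regroup = ℕsolve 4 (λ i a b c → (ℕcon 2 ⊹ i) ⊗ (a ⊹ b) ⊹ (ℕcon 1 ⊹ i) ⊗ (c ⊹ a)
                                ≐ ((ℕcon 2 ⊹ i) ⊗ b ⊹ (ℕcon 1 ⊹ i) ⊗ a) ⊹ ((ℕcon 1 ⊹ i) ⊗ a ⊹ i ⊗ c) ⊹ a ⊹ c) refl
  collect : ∀ p a c → p ℕ.* a ℕ.+ p ℕ.* c ℕ.+ a ℕ.+ c ≡ suc p ℕ.* (c ℕ.+ a)
  collect = ℕsolve 3 (λ p a c → p ⊗ a ⊹ p ⊗ c ⊹ a ⊹ c ≐ (ℕcon 1 ⊹ p) ⊗ (c ⊹ a)) refl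

-- Where an index m sits relative to p; the coefficient recurrences below change
-- form at m = p.
data Position (p m : ℕ) : Set where
  below : ∀ o → m ℕ.+ suc o ≡ p → Position p m
  at    : m ≡ p → Position p m
  above : ∀ k → m ≡ suc (p ℕ.+ k) → Position p m

position : ∀ p m → Position p m
position p m with ℕP.<-cmp m p
... | tri< m<p _ _ with ℕP.m≤n⇒∃[o]m+o≡n m<p
...   | o , eq = below o (trans (ℕP.+-suc m o) eq)
position p m | tri≈ _ m≡p _ = at m≡p
position p m | tri> _ _ m>p with ℕP.m≤n⇒∃[o]m+o≡n m>p
...   | k , eq = above k (sym eq)

below⇒< : ∀ {p m} o → m ℕ.+ suc o ≡ p → m ℕ.< p
below⇒< {p} {m} o eq = subst (m ℕ.<_) eq (ℕP.m<m+n m (s≤s z≤n))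

sgn : ℕ → ℚ
sgn zero    = 1ℚ
sgn (suc k) = - sgn k

oneMinusExp^ : ∀ m → oneMinusExp ^ₚ m ≈ sgn m · (u ^ₚ m)
oneMinusExp^ zero    n = sym (*-identityˡ (one n))
oneMinusExp^ (suc m) n = begin
    (oneMinusExp ⊛ (oneMinusExp ^ₚ m)) n
  ≡⟨ ⊛-cong {oneMinusExp} {(- 1ℚ) · u} {oneMinusExp ^ₚ m} {sgn m · (u ^ₚ m)} (λ i → neg (u i)) (oneMinusExp^ m) n ⟩
    (((- 1ℚ) · u) ⊛ (sgn m · (u ^ₚ m))) n
  ≡⟨ trans (⊛-scalˡ (- 1ℚ) u (sgn m · (u ^ₚ m)) n) (cong ((- 1ℚ) *_) (⊛-scalʳ (sgn m) u (u ^ₚ m) n)) ⟩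
    (- 1ℚ) * (sgn m * (u ^ₚ suc m) n)
  ≡⟨ sign (sgn m) ((u ^ₚ suc m) n) ⟩
    - sgn m * (u ^ₚ suc m) n
  ∎
  where
  open ≡-Reasoning
  neg : ∀ x → - x ≡ (- 1ℚ) * x
  neg = solve 1 (λ x → :- x := (:- con 1ℚ) :* x) refl
  sign : ∀ s x → (- 1ℚ) * (s * x) ≡ - s * x
  sign = solve 2 (λ s x → (:- con 1ℚ) :* (s :* x) := (:- s) :* x) refl

Φ-zero : Φ (λ _ → 0ℚ) ≈ (λ _ → 0ℚ)
Φ-zero n = Σ-zero n _ (λ m _ → *-zeroˡ ((u ^ₚ m) n))

vanishing : ∀ a b c d {x y z w} → x ≡ 0ℚ → y ≡ 0ℚ → z ≡ 0ℚ → w ≡ 0ℚ → a * x + b * y ≡ c * z + d * w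
vanishing a b c d refl refl refl refl =
  solve 4 (λ a b c d → a :* con 0ℚ :+ b :* con 0ℚ := c :* con 0ℚ :+ d :* con 0ℚ) refl a b c d

module ForFixed (p : ℕ) where

  P Q : ℚ
  P = ℕ→ℚ p
  Q = ℕ→ℚ (suc p)

  c : ℕ → ℚ
  c = hypCoeff 1 1 (suc p)

  a : ℕ → ℚ
  a k = sgn k * c k

  L : PS
  L = ₂F₁∘ 1 1 (suc p) oneMinusExp

  -- (1 - e^t)^m = (-1)^m u^m turns L into a series in u.
  L-in-u : L ≈ Φ a
  L-in-u n = Σ-cong n (λ m → trans (cong (c m *_) (oneMinusExp^ m n)) (regroup (c m) (sgn m) ((u ^ₚ m) n)))
    where
    regroup : ∀ x s y → x * (s * y) ≡ (s * x) * y
    regroup = solve 3 (λ x s y → x :* (s :* y) := (s :* x) :* y) refl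

  c-step : ∀ k → ℕ→ℚ (suc (suc (p ℕ.+ k))) * c (suc k) ≡ ℕ→ℚ (suc k) * c k
  c-step k = begin
      M * (c k * (r * (pos (suc k) / suc k)))   ≡⟨ cong (λ x → M * (c k * (r * x))) (/-self k) ⟩
      M * (c k * (r * 1ℚ))                      ≡⟨ regroup M (c k) r ⟩
      (M * r) * c k                             ≡⟨ cong (_* c k) (*-cancel-/ (suc k) (suc (p ℕ.+ k))) ⟩
      ℕ→ℚ (suc k) * c k                         ∎
    where
    open ≡-Reasoning
    M = ℕ→ℚ (suc (suc (p ℕ.+ k)))
    r = pos (suc k) / suc (suc (p ℕ.+ k))
    regroup : ∀ m x r → m * (x * (r * 1ℚ)) ≡ (m * r) * x
    regroup = solve 3 (λ m x r → m :* (x :* (r :* con 1ℚ)) := (m :* r) :* x) refl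

  a-step : ∀ k → ℕ→ℚ (suc (suc (p ℕ.+ k))) * a (suc k) ≡ - (ℕ→ℚ (suc k) * a k)
  a-step k = begin
      M * (- sgn k * c (suc k))          ≡⟨ pull M (sgn k) (c (suc k)) ⟩
      - (sgn k * (M * c (suc k)))        ≡⟨ cong (λ x → - (sgn k * x)) (c-step k) ⟩
      - (sgn k * (ℕ→ℚ (suc k) * c k))    ≡⟨ cong -_ (push (sgn k) (ℕ→ℚ (suc k)) (c k)) ⟩
      - (ℕ→ℚ (suc k) * (sgn k * c k))    ∎
    where
    open ≡-Reasoning
    M = ℕ→ℚ (suc (suc (p ℕ.+ k)))
    pull : ∀ m s x → m * (- s * x) ≡ - (s * (m * x))
    pull = solve 3 (λ m s x → m :* ((:- s) :* x) := :- (s :* (m :* x))) refl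
    push : ∀ s k x → s * (k * x) ≡ k * (s * x)
    push = solve 3 (λ s k x → s :* (k :* x) := k :* (s :* x)) refl

  -- Coefficients (in u) of Y = u^{p+1} L, and of u^p.
  ψ δ : ℕ → ℚ
  ψ = shiftBy (suc p) a
  δ = shiftBy p one

  δ-above : ∀ k → δ (suc (p ℕ.+ k)) ≡ 0ℚ
  δ-above k = trans (cong δ (sym (ℕP.+-suc p k))) (shiftBy-above p one (suc k))

  -- Y' = p Y + (p+1) u^p, on coefficients.
  ψ-rec : ∀ m → 𝒟 ψ m ≡ P * ψ m + Q * δ m
  ψ-rec m with position p m
  ... | below o eq = vanishing (ℕ→ℚ (suc m)) (ℕ→ℚ m) P Q
          (shiftBy-below p a m m<p) ψ-zero ψ-zero (shiftBy-below p one m m<p)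
    where
    m<p = below⇒< o eq
    ψ-zero = shiftBy-below (suc p) a m (ℕP.m<n⇒m<1+n m<p)
  ... | at refl = begin
      Q * shiftBy p a p + P * ψ p    ≡⟨ cong₂ (λ x y → Q * x + P * y) (shiftBy-at p a) ψ-zero ⟩
      Q * (1ℚ * 1ℚ) + P * 0ℚ         ≡⟨ solve 2 (λ q r → q :* (con 1ℚ :* con 1ℚ) :+ r :* con 0ℚ := r :* con 0ℚ :+ q :* con 1ℚ) refl Q P ⟩
      P * 0ℚ + Q * 1ℚ                ≡⟨ sym (cong₂ (λ x y → P * x + Q * y) ψ-zero (shiftBy-at p one)) ⟩
      P * ψ p + Q * δ p              ∎
    where
    open ≡-Reasoning
    ψ-zero = shiftBy-below (suc p) a p (ℕP.n<1+n p)
  ... | above k refl = begin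
      ℕ→ℚ (suc (suc (p ℕ.+ k))) * shiftBy p a (suc (p ℕ.+ k)) + ℕ→ℚ (suc (p ℕ.+ k)) * shiftBy p a (p ℕ.+ k)
    ≡⟨ cong₂ (λ x y → ℕ→ℚ (suc (suc (p ℕ.+ k))) * x + ℕ→ℚ (suc (p ℕ.+ k)) * y) a₁ (shiftBy-above p a k) ⟩
      ℕ→ℚ (suc (suc (p ℕ.+ k))) * a (suc k) + ℕ→ℚ (suc (p ℕ.+ k)) * a k
    ≡⟨ cong₂ (λ x y → x + y * a k) (a-step k) (trans (cong ℕ→ℚ (sym (ℕP.+-suc p k))) (ℕ→ℚ-+ p (suc k))) ⟩
      - (ℕ→ℚ (suc k) * a k) + (P + ℕ→ℚ (suc k)) * a k
    ≡⟨ solve 4 (λ j x p q → :- (j :* x) :+ (p :+ j) :* x := p :* x :+ q :* con 0ℚ) refl (ℕ→ℚ (suc k)) (a k) P Q ⟩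
      P * a k + Q * 0ℚ
    ≡⟨ sym (cong₂ (λ x y → P * x + Q * y) (shiftBy-above p a k) (δ-above k)) ⟩
      P * ψ (suc (p ℕ.+ k)) + Q * δ (suc (p ℕ.+ k))
    ∎
    where
    open ≡-Reasoning
    a₁ : shiftBy p a (suc (p ℕ.+ k)) ≡ a (suc k)
    a₁ = trans (cong (shiftBy p a) (sym (ℕP.+-suc p k))) (shiftBy-above p a (suc k))

  -- Binomial coefficients C(p,j): e^{pt} = (1 + u)^p = Σ_j C(p,j) u^j.
  β : ℕ → ℚ
  β j = ℕ→ℚ (p C j)

  -- Binomial absorption over ℚ, i.e. 𝒟 β = p β: (1 + u)^p solves y' = p y.
  β-absorb : ∀ j → ℕ→ℚ (suc j) * β (suc j) + ℕ→ℚ j * β j ≡ P * β j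
  β-absorb j = begin
      ℕ→ℚ (suc j) * β (suc j) + ℕ→ℚ j * β j
    ≡⟨ sym (cong₂ _+_ (ℕ→ℚ-* (suc j) (p C suc j)) (ℕ→ℚ-* j (p C j))) ⟩
      ℕ→ℚ (suc j ℕ.* (p C suc j)) + ℕ→ℚ (j ℕ.* (p C j))
    ≡⟨ sym (ℕ→ℚ-+ (suc j ℕ.* (p C suc j)) (j ℕ.* (p C j))) ⟩
      ℕ→ℚ (suc j ℕ.* (p C suc j) ℕ.+ j ℕ.* (p C j))
    ≡⟨ cong ℕ→ℚ (binomial-absorption p j) ⟩
      ℕ→ℚ (p ℕ.* (p C j))
    ≡⟨ ℕ→ℚ-* p (p C j) ⟩
      P * β j
    ∎
    where open ≡-Reasoning

  β-above : ∀ j → p ℕ.< j → β j ≡ 0ℚ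
  β-above j p<j = cong ℕ→ℚ (k>n⇒nCk≡0 p<j)

  -- e^{pt} = Σ_j C(p,j) u^j: both solve y' = p y with y(0) = 1.
  exp-binomial : expPS p ≈ Φ β
  exp-binomial = ode-unique (expPS p) (Φ β) P (λ _ → 0ℚ) exp-ode β-ode refl
    where
    exp-ode : ∀ n → D (expPS p) n ≡ P * expPS p n + 0ℚ
    exp-ode n = trans (D-exp p n) (sym (+-identityʳ _))
    β-ode : ∀ n → D (Φ β) n ≡ P * Φ β n + 0ℚ
    β-ode n = trans (Φ-ode β P (λ _ → 0ℚ) (λ j → trans (β-absorb j) (sym (+-identityʳ _))) n)
                    (cong (P * Φ β n +_) (Φ-zero n))

  σ : ℕ → ℚ
  σ j = β j * H (p ∸ j)

  -- The harmonic sum S = Φ σ satisfies S' = p S + u^p - e^{pt}, on coefficients.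
  σ-rec : ∀ j → β j + 𝒟 σ j ≡ P * σ j + δ j
  σ-rec j with position p j
  ... | below o eq = begin
      β j + (ℕ→ℚ (suc j) * (β (suc j) * H (p ∸ suc j)) + J * (β j * H (p ∸ j)))
    ≡⟨ cong₂ (λ x y → β j + (ℕ→ℚ (suc j) * (β (suc j) * H x) + J * (β j * H y))) gap₁ gap ⟩
      β j + (ℕ→ℚ (suc j) * (β (suc j) * H o) + J * (β j * (H o + i)))
    ≡⟨ expand (β j) (ℕ→ℚ (suc j)) (β (suc j)) (H o) J i ⟩
      (ℕ→ℚ (suc j) * β (suc j) + J * β j) * H o + (β j + J * β j * i)
    ≡⟨ cong₂ (λ x y → x * H o + (y + J * β j * i)) (β-absorb j) unit ⟩
      P * β j * H o + (R * i * β j + J * β j * i)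
    ≡⟨ cong (P * β j * H o +_) (trans (collect R i (β j) J) (cong (λ x → x * β j * i) (sym P≡))) ⟩
      P * β j * H o + P * β j * i
    ≡⟨ factor P (β j) (H o) i ⟩
      P * (β j * (H o + i)) + 0ℚ
    ≡⟨ cong₂ (λ x y → P * (β j * H x) + y) (sym gap) (sym (shiftBy-below p one j (below⇒< o eq))) ⟩
      P * σ j + δ j
    ∎
    where
    open ≡-Reasoning
    J = ℕ→ℚ j
    R = ℕ→ℚ (suc o)
    i = pos 1 / suc o
    gap : p ∸ j ≡ suc o
    gap = trans (cong (_∸ j) (sym eq)) (ℕP.m+n∸m≡n j (suc o))
    gap₁ : p ∸ suc j ≡ o
    gap₁ = trans (cong (_∸ suc j) (trans (sym eq) (ℕP.+-suc j o))) (ℕP.m+n∸m≡n (suc j) o)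
    P≡ : P ≡ J + R
    P≡ = trans (cong ℕ→ℚ (sym eq)) (ℕ→ℚ-+ j (suc o))
    unit : β j ≡ R * i * β j
    unit = sym (trans (cong (_* β j) (*-cancel-/ 1 o)) (*-identityˡ (β j)))
    expand : ∀ b j₁ b₁ h j i → b + (j₁ * (b₁ * h) + j * (b * (h + i))) ≡ (j₁ * b₁ + j * b) * h + (b + j * b * i)
    expand = solve 6 (λ b j₁ b₁ h j i → b :+ (j₁ :* (b₁ :* h) :+ j :* (b :* (h :+ i)))
                                      := (j₁ :* b₁ :+ j :* b) :* h :+ (b :+ j :* b :* i)) refl
    collect : ∀ r i b j → r * i * b + j * b * i ≡ (j + r) * b * i
    collect = solve 4 (λ r i b j → r :* i :* b :+ j :* b :* i := (j :+ r) :* b :* i) refl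
    factor : ∀ p b h i → p * b * h + p * b * i ≡ p * (b * (h + i)) + 0ℚ
    factor = solve 4 (λ p b h i → p :* b :* h :+ p :* b :* i := p :* (b :* (h :+ i)) :+ con 0ℚ) refl
  ... | at refl = begin
      β p + (Q * (β (suc p) * H (p ∸ suc p)) + P * σ p)
    ≡⟨ cong₂ (λ x y → x + (Q * (y * H (p ∸ suc p)) + P * σ p)) (cong ℕ→ℚ (nCn≡1 p)) (β-above (suc p) (ℕP.n<1+n p)) ⟩
      1ℚ + (Q * (0ℚ * H (p ∸ suc p)) + P * σ p)
    ≡⟨ solve 3 (λ q h x → con 1ℚ :+ (q :* (con 0ℚ :* h) :+ x) := x :+ con 1ℚ) refl Q (H (p ∸ suc p)) (P * σ p) ⟩
      P * σ p + 1ℚ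
    ≡⟨ cong (P * σ p +_) (sym (shiftBy-at p one)) ⟩
      P * σ p + δ p
    ∎
    where open ≡-Reasoning
  ... | above k refl = begin
      β j + (ℕ→ℚ (suc j) * (β (suc j) * h₁) + ℕ→ℚ j * (β j * h))
    ≡⟨ cong₂ (λ x y → x + (ℕ→ℚ (suc j) * (y * h₁) + ℕ→ℚ j * (x * h))) βj≡0 βj₁≡0 ⟩
      0ℚ + (ℕ→ℚ (suc j) * (0ℚ * h₁) + ℕ→ℚ j * (0ℚ * h))
    ≡⟨ solve 5 (λ j₁ j p h₁ h → con 0ℚ :+ (j₁ :* (con 0ℚ :* h₁) :+ j :* (con 0ℚ :* h)) := p :* (con 0ℚ :* h) :+ con 0ℚ)
               refl (ℕ→ℚ (suc j)) (ℕ→ℚ j) P h₁ h ⟩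
      P * (0ℚ * h) + 0ℚ
    ≡⟨ sym (cong₂ (λ x y → P * (x * h) + y) βj≡0 (δ-above k)) ⟩
      P * σ j + δ j
    ∎
    where
    open ≡-Reasoning
    h = H (p ∸ j)
    h₁ = H (p ∸ suc j)
    βj≡0 = β-above j (s≤s (ℕP.m≤m+n p k))
    βj₁≡0 = β-above (suc j) (s≤s (ℕP.m≤n⇒m≤1+n (ℕP.m≤m+n p k)))

  Y W S Z₀ Z : PS
  Y  = (u ^ₚ suc p) ⊛ L
  W  = (X ⊕ const (- H p)) ⊛ expPS p
  S  = Φ σ
  Z₀ = W ⊕ S
  Z  = Q · Z₀

  Y-in-u : Y ≈ Φ ψ
  Y-in-u = ≈-trans (⊛-congʳ (u ^ₚ suc p) L-in-u) (Φ-shiftBy (suc p) a)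

  Φψ-ode : ∀ n → D (Φ ψ) n ≡ P * Φ ψ n + (Q · (u ^ₚ p)) n
  Φψ-ode n = trans (Φ-ode ψ P (Q · δ) ψ-rec n)
                   (cong (P * Φ ψ n +_) (trans (Φ-· Q δ n) (cong (Q *_) (Φ-unit p n))))

  W-derivative : ∀ n → D W n ≡ expPS p n + P * W n
  W-derivative n = trans (D-⊛ line (expPS p) n)
    (cong₂ _+_ (trans (⊛-congˡ (expPS p) D-line n) (⊛-identityˡ (expPS p) n))
               (trans (⊛-congʳ line (D-exp p) n) (⊛-scalʳ P line (expPS p) n)))
    where
    line = X ⊕ const (- H p)
    D-line : D line ≈ one
    D-line zero    = trans (D-⊕ X (const (- H p)) 0) (trans (cong₂ _+_ (*-identityˡ 1ℚ) (*-zeroʳ 1ℚ)) (+-identityʳ 1ℚ))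
    D-line (suc n) = trans (D-⊕ X (const (- H p)) (suc n))
      (trans (cong₂ _+_ (*-zeroʳ (ℕ→ℚ (suc (suc n)))) (*-zeroʳ (ℕ→ℚ (suc (suc n))))) (+-identityʳ 0ℚ))

  Z₀-ode : ∀ n → D Z₀ n ≡ P * Z₀ n + (u ^ₚ p) n
  Z₀-ode n = begin
      D Z₀ n
    ≡⟨ D-⊕ W S n ⟩
      D W n + D S n
    ≡⟨ cong₂ _+_ (trans (W-derivative n) (cong (_+ P * W n) (exp-binomial n))) (D-Φ σ n) ⟩
      (Φ β n + P * W n) + Φ (𝒟 σ) n
    ≡⟨ regroup (Φ β n) (P * W n) (Φ (𝒟 σ) n) ⟩
      P * W n + (Φ β n + Φ (𝒟 σ) n)
    ≡⟨ cong (P * W n +_) (trans (sym (Φ-⊕ β (𝒟 σ) n)) (Φ-cong σ-rec n)) ⟩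
      P * W n + Φ ((P · σ) ⊕ δ) n
    ≡⟨ cong (P * W n +_) (trans (Φ-⊕ (P · σ) δ n) (cong₂ _+_ (Φ-· P σ n) (Φ-unit p n))) ⟩
      P * W n + (P * S n + (u ^ₚ p) n)
    ≡⟨ factor P (W n) (S n) ((u ^ₚ p) n) ⟩
      P * Z₀ n + (u ^ₚ p) n
    ∎
    where
    open ≡-Reasoning
    regroup : ∀ a b c → (a + b) + c ≡ b + (a + c)
    regroup = solve 3 (λ a b c → (a :+ b) :+ c := b :+ (a :+ c)) refl
    factor : ∀ p w s x → p * w + (p * s + x) ≡ p * (w + s) + x
    factor = solve 4 (λ p w s x → p :* w :+ (p :* s :+ x) := p :* (w :+ s) :+ x) refl

  Z-ode : ∀ n → D Z n ≡ P * Z n + (Q · (u ^ₚ p)) n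
  Z-ode n = trans (D-· Q Z₀ n) (trans (cong (Q *_) (Z₀-ode n)) (distribute Q P (Z₀ n) ((u ^ₚ p) n)))
    where
    distribute : ∀ q p z x → q * (p * z + x) ≡ p * (q * z) + q * x
    distribute = solve 4 (λ q p z x → q :* (p :* z :+ x) := p :* (q :* z) :+ q :* x) refl

  -- At t = 0: -H_p + C(p,0) H_p = 0.
  Z-at-0 : Z 0 ≡ 0ℚ
  Z-at-0 = trans (cong (Q *_) (cancels (H p))) (*-zeroʳ Q)
    where
    cancels : ∀ h → (0ℚ + - h) * 1ℚ + (1ℚ * h) * 1ℚ ≡ 0ℚ
    cancels = solve 1 (λ h → (con 0ℚ :+ (:- h)) :* con 1ℚ :+ (con 1ℚ :* h) :* con 1ℚ := con 0ℚ) refl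

  -- The key identity u^{p+1} L = Z: both solve y' = p y + (p+1) u^p, y(0) = 0.
  Y≈Z : Y ≈ Z
  Y≈Z = ≈-trans Y-in-u (ode-unique (Φ ψ) Z P (Q · (u ^ₚ p)) Φψ-ode Z-ode (trans (*-zeroˡ 1ℚ) (sym Z-at-0)))

  -- Dividing by u^{p+1} = t^{p+1} g^{p+1}: multiply by G = g^{-(p+1)}, then shift.
  K : ℕ
  K = suc p

  G : PS
  G = g⁻¹ ^ₚ K

  u^K-⊛-G : (u ^ₚ K) ⊛ G ≈ X ^ₚ K
  u^K-⊛-G n = trans (cong (λ m → ((u ^ₚ K) ⊛ (g⁻¹ ^ₚ m)) n) (sym (ℕP.+-identityʳ K)))
                    (trans (u^-⊛-g⁻¹^ K 0 n) (⊛-identityʳ (X ^ₚ K) n))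

  Z-over-u^K : ∀ z → ev (z ℤ.+ pos K) (Z ⊛ G) ≡ ev z L
  Z-over-u^K z = trans (ev-cong (z ℤ.+ pos K) Z⊛G≈) (ev-X^ K L z)
    where
    Z⊛G≈ : Z ⊛ G ≈ (X ^ₚ K) ⊛ L
    Z⊛G≈ = ≈-trans (⊛-congˡ G (≈-sym Y≈Z)) (≈-trans (⊛-congˡ G (⊛-comm (u ^ₚ K) L))
           (≈-trans (⊛-assoc L (u ^ₚ K) G) (≈-trans (⊛-congʳ L u^K-⊛-G) (⊛-comm L (X ^ₚ K)))))

  Z-over-u^K-split : ∀ w → ev w (Z ⊛ G) ≡ Q * (ev w (W ⊛ G) + ev w (S ⊛ G))
  Z-over-u^K-split w = trans (ev-cong w (≈-trans (⊛-scalˡ Q Z₀ G) (·-cong Q (⊛-distribʳ W S G))))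
    (trans (ev-· w Q ((W ⊛ G) ⊕ (S ⊛ G))) (cong (Q *_) (ev-⊕ w (W ⊛ G) (S ⊛ G))))

  S-polynomial : S ≈ (λ n → Σ0 p (λ j → σ j * (u ^ₚ j) n))
  S-polynomial n = trans (Φ-extend σ n (n ℕ.+ p) (ℕP.m≤m+n n p))
    (Σ-extend p (n ℕ.+ p) _ (ℕP.m≤n+m p n)
      (λ j p<j → trans (cong (λ x → x * H (p ∸ j) * (u ^ₚ j) n) (β-above j p<j))
                       (trans (cong (_* (u ^ₚ j) n) (*-zeroˡ (H (p ∸ j)))) (*-zeroˡ ((u ^ₚ j) n)))))

  harmonic-term : ∀ z k → k ℕ.≤ p →
                  σ (p ∸ k) * ev (z ℤ.+ pos K) ((u ^ₚ (p ∸ k)) ⊛ G)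
                  ≡ (ℕ→ℚ (p C k) * H k) * ev (z ℤ.+ pos (suc k)) (g⁻¹ ^ₚ suc k)
  harmonic-term z k k≤p =
    cong₂ _*_ (cong₂ _*_ (cong ℕ→ℚ (sym (nCk≡nC[n∸k] k≤p))) (cong H (ℕP.m∸[m∸n]≡n k≤p)))
      (trans (cong (λ m → ev (z ℤ.+ pos m) ((u ^ₚ (p ∸ k)) ⊛ (g⁻¹ ^ₚ m))) K≡)
      (trans (ev-cong (z ℤ.+ pos ((p ∸ k) ℕ.+ suc k)) (u^-⊛-g⁻¹^ (p ∸ k) (suc k)))
      (trans (cong (λ v → ev v ((X ^ₚ (p ∸ k)) ⊛ (g⁻¹ ^ₚ suc k))) exponent)
             (ev-X^ (p ∸ k) (g⁻¹ ^ₚ suc k) (z ℤ.+ pos (suc k))))))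
    where
    K≡ : suc p ≡ (p ∸ k) ℕ.+ suc k
    K≡ = trans (cong suc (sym (ℕP.m∸n+n≡m k≤p))) (sym (ℕP.+-suc (p ∸ k) k))
    exponent : z ℤ.+ pos ((p ∸ k) ℕ.+ suc k) ≡ (z ℤ.+ pos (suc k)) ℤ.+ pos (p ∸ k)
    exponent = trans (cong (ℤ._+_ z) (trans (cong pos (ℕP.+-comm (p ∸ k) (suc k))) (ℤP.pos-+ (suc k) (p ∸ k))))
                     (sym (ℤP.+-assoc z (pos (suc k)) (pos (p ∸ k))))

  -- S / u^{p+1} = Σ_{k=1}^{p} C(p,k) H_k / u^{k+1}  (the k = 0 term has H_0 = 0).
  harmonic-part : ∀ z → ΣL1 p (λ k → (ℕ→ℚ (p C k) * H k) ·ₗ invExpm1^ (suc k)) z ≡ ev (z ℤ.+ pos K) (S ⊛ G)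
  harmonic-part z = begin
      ΣL1 p (λ k → (ℕ→ℚ (p C k) * H k) ·ₗ invExpm1^ (suc k)) z
    ≡⟨ trans (ΣL1-coeff p _ z) (Σ1-cong p (λ k → cong (ℕ→ℚ (p C k) * H k *_) (ev-t⁻^ (suc k) (g⁻¹ ^ₚ suc k) z))) ⟩
      Σ1 p T
    ≡⟨ sym (trans (cong (_+ Σ1 p T) (*-zeroˡ (ev (z ℤ.+ pos 1) (g⁻¹ ^ₚ 1)))) (+-identityˡ (Σ1 p T))) ⟩
      T 0 + Σ1 p T
    ≡⟨ sym (Σ0-Σ1 p T) ⟩
      Σ0 p T
    ≡⟨ sym (Σ-cong≤ p (harmonic-term z)) ⟩
      Σ0 p (λ k → σ (p ∸ k) * ev w ((u ^ₚ (p ∸ k)) ⊛ G))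
    ≡⟨ sym (Σ-reverse p _) ⟩
      Σ0 p (λ j → σ j * ev w ((u ^ₚ j) ⊛ G))
    ≡⟨ sym (trans (ev-Σ w p (λ j → σ j · ((u ^ₚ j) ⊛ G))) (Σ-cong p (λ j → ev-· w (σ j) ((u ^ₚ j) ⊛ G)))) ⟩
      ev w (λ n → Σ0 p (λ j → σ j * ((u ^ₚ j) ⊛ G) n))
    ≡⟨ sym (ev-cong w (≈-trans (⊛-congˡ G S-polynomial) (Σ-⊛ p σ (u ^ₚ_) G))) ⟩
      ev w (S ⊛ G)
    ∎
    where
    open ≡-Reasoning
    w = z ℤ.+ pos K
    T : ℕ → ℚ
    T k = (ℕ→ℚ (p C k) * H k) * ev (z ℤ.+ pos (suc k)) (g⁻¹ ^ₚ suc k)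

  L-coefficients : ∀ z → ev z L ≡ LHS p z
  L-coefficients (pos n) = sym (begin
      ℕ→ℚ (n !) * L n * inv! n     ≡⟨ regroup (ℕ→ℚ (n !)) (L n) (inv! n) ⟩
      L n * (ℕ→ℚ (n !) * inv! n)   ≡⟨ cong (L n *_) (!-inverse n) ⟩
      L n * 1ℚ                     ≡⟨ *-identityʳ (L n) ⟩
      L n                          ∎)
    where
    open ≡-Reasoning
    regroup : ∀ a x b → (a * x) * b ≡ x * (a * b)
    regroup = solve 3 (λ a x b → (a :* x) :* b := x :* (a :* b)) refl
  L-coefficients -[1+ _ ] = refl

theorem1p1 : (p : ℕ) → (z : ℤ) → RHS p z ≡ LHS p z
theorem1p1 p z = begin
    RHS p z
  ≡⟨ cong₂ (λ x y → Q * x + Q * y) (ev-t⁻^ K (W ⊛ G) z) (harmonic-part z) ⟩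
    Q * ev w (W ⊛ G) + Q * ev w (S ⊛ G)
  ≡⟨ sym (*-distribˡ-+ Q (ev w (W ⊛ G)) (ev w (S ⊛ G))) ⟩
    Q * (ev w (W ⊛ G) + ev w (S ⊛ G))
  ≡⟨ sym (Z-over-u^K-split w) ⟩
    ev w (Z ⊛ G)
  ≡⟨ Z-over-u^K z ⟩
    ev z L
  ≡⟨ L-coefficients z ⟩
    LHS p z
  ∎
  where
  open ≡-Reasoning
  open ForFixed p
  w = z ℤ.+ pos K
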